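{- Let $p\geq 1$ be an integer and let $(a_n^{(k)})_{n\in\mathbb{Z}}$, $0\leq k\leq p$, be bi-infinite sequences of complex numbers. With the lattice paths, weights and formal power series defined in the context, the following identities hold in $\mathbb{C}((z^{ -1}))$: \[ zA_{0}(z)-1=\sum_{j=0}^{p} a_{0}^{(j)} A_{j}(z), \qquad A_{j}(z)=A_{i}(z)\,A_{j-i-1}^{(i+1)}(z)\quad\text{for all } 0\leq i<j\leq p. \]
   Context: $\mathbb{C}((z^{ -1}))$ denotes the field of formal series $\sum_{n\in\mathbb{Z}} c_n z^{ -n}$ with complex coefficients and only finitely many nonzero $c_n$ with $n<0$. Lattice paths have vertices in $\mathbb{Z}_{\geq 0}\times\mathbb{Z}$ and are finite sequences of steps, consecutive steps sharing endpoints; the allowed steps are upsteps $(n,m)\to(n+1,m+1)$, level steps $(n,m)\to(n+1,m)$, and downsteps $(n,m)\to(n+1,m-j)$ with $1\leq j\leq p$. The length of a path is its number of steps (a path of length $0$ is a single vertex). Weights: every upstep has weight $1$; a step $(n,m)\to(n+1,m-j)$ with $0\leq j\leq p$ has weight $a_{m-j}^{(j)}$. The weight $w(\gamma)$ of a path is the product of the weights of its steps ($1$ for a path of length $0$). For an integer $q$, $\gamma+q$ denotes the path shifted vertically by $q$ units. $\min(\gamma)$ is the minimal height of the vertices of $\gamma$. For $n\geq0$ and $0\leq j\leq p$, $\mathcal{D}_{[n,j]}$ is the set of paths of length $n$ from $(0,0)$ to $(n,j)$ with $\min(\gamma)=0$. For integers $q\geq 0$ put $A_{[n,j]}^{(q)}=\sum_{\gamma\in\mathcal{D}_{[n,j]}}w(\gamma+q)$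 (an empty sum is $0$), $A_{[n,j]}=A_{[n,j]}^{(0)}$, and define the formal series $A_j^{(q)}(z)=\sum_{n=0}^\infty A^{(q)}_{[n,j]}z^{ -n-1}$, $A_j(z)=A_j^{(0)}(z)$. -}

module Defs where

open import Level using (Level)
open import Algebra.Bundles using (CommutativeRing)
open import Data.Nat as ℕ using (ℕ; zero; suc; _⊔_; _∸_)
open import Data.Integer as ℤ using (ℤ; +_; -[1+_]; _≤?_)
open import Data.Fin using (Fin; toℕ)
open import Data.List using (List; []; _∷_; map; foldr; upTo; allFin; concatMap; filterᵇ)
open import Data.Bool using (Bool; true; false; _∧_)
open import Relation.Nullary using (does)
open import Relation.Binary.PropositionalEquality using (_≡_)

-- A series is given by a natural number `ord` and coefficients `coeff`,
-- representing  Σ_{n ≥ 0} coeff n · z^(ord - n).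

module Laurent {c ℓ : Level} (R : CommutativeRing c ℓ) where
  open CommutativeRing R

  record LS : Set c where
    constructor mkLS
    field
      ord   : ℕ
      coeff : ℕ → Carrier
  open LS public

  coef : LS → ℤ → Carrier
  coef f e with (+ ord f) ℤ.- e
  ... | + k = coeff f k
  ... | -[1+ _ ] = 0#

  infix 4 _≈L_
  _≈L_ : LS → LS → Set ℓ
  f ≈L g = (e : ℤ) → coef f e ≈ coef g e

  zeroL : LS
  zeroL = mkLS 0 (λ _ → 0#)

  oneL : LS
  oneL = mkLS 0 (λ { zero → 1# ; (suc _) → 0# })

  infixl 6 _+L_ _-L_
  infixl 7 _*L_ _•L_

  _+L_ : LS → LS → LS
  f +L g = mkLS m (λ n → coef f ((+ m) ℤ.- (+ n)) + coef g ((+ m) ℤ.- (+ n)))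
    where m = ord f ⊔ ord g

  _•L_ : Carrier → LS → LS
  s •L f = mkLS (ord f) (λ n → s * coeff f n)

  _-L_ : LS → LS → LS
  f -L g = f +L ((- 1#) •L g)

  sumR : List Carrier → Carrier
  sumR = foldr _+_ 0#

  _*L_ : LS → LS → LS
  f *L g = mkLS (ord f ℕ.+ ord g)
    (λ n → sumR (map (λ k → coeff f k * coeff g (n ∸ k)) (upTo (suc n))))

  zL : LS → LS
  zL f = mkLS (suc (ord f)) (coeff f)

  ΣL : (n : ℕ) → (Fin n → LS) → LS
  ΣL n F = foldr _+L_ zeroL (map F (allFin n))

-- Lattice paths with up steps, and steps (n,m) → (n+1,m-j), 0 ≤ j ≤ p
-- (j = 0 is a level step, 1 ≤ j ≤ p a down step).

data Step (p : ℕ) : Set where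
  up   : Step p
  down : Fin (suc p) → Step p

allSteps : (p : ℕ) → List (Step p)
allSteps p = up ∷ map down (allFin (suc p))

allPaths : (p : ℕ) → ℕ → List (List (Step p))
allPaths p zero    = [] ∷ []
allPaths p (suc n) = concatMap (λ s → map (s ∷_) (allPaths p n)) (allSteps p)

next : {p : ℕ} → ℤ → Step p → ℤ
next h up       = h ℤ.+ (+ 1)
next h (down j) = h ℤ.- (+ toℕ j)

endHeight : {p : ℕ} → ℤ → List (Step p) → ℤ
endHeight h []       = h
endHeight h (s ∷ ss) = endHeight (next h s) ss

nonneg : {p : ℕ} → ℤ → List (Step p) → Bool
nonneg h []       = true
nonneg h (s ∷ ss) = does ((+ 0) ≤? next h s) ∧ nonneg (next h s) ss

-- membership in 𝒟_[n,j] for a path of length n from (0,0): ends at height j,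
-- and min = 0 (the start vertex has height 0 and all other vertices ≥ 0)
inD : {p : ℕ} → ℕ → List (Step p) → Bool
inD j γ = does (endHeight (+ 0) γ ℤ.≟ (+ j)) ∧ nonneg (+ 0) γ

module Paths {c ℓ : Level} (R : CommutativeRing c ℓ) (p : ℕ)
             (a : Fin (suc p) → ℤ → CommutativeRing.Carrier R) where
  open CommutativeRing R
  open Laurent R

  -- weight of the path γ started at height h (i.e. w(γ + h) for h = q)
  weight : ℤ → List (Step p) → Carrier
  weight h []              = 1#
  weight h (up ∷ ss)       = 1# * weight (h ℤ.+ (+ 1)) ss
  weight h (down j ∷ ss)   = a j (h ℤ.- (+ toℕ j)) * weight (h ℤ.- (+ toℕ j)) ss

  Acoef : (q : ℕ) → (n j : ℕ) → Carrier
  Acoef q n j = sumR (map (weight (+ q)) (filterᵇ (inD j) (allPaths p n)))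

  -- A^{(q)}_j(z) = Σ_{n ≥ 0} A^{(q)}_{[n,j]} z^{-n-1}
  A : (q : ℕ) → (j : ℕ) → LS
  A q j = mkLS 0 (λ { zero → 0# ; (suc n) → Acoef q n j })

{-# OPTIONS --safe #-}
module Submission where

-- Splitting off the last step of a path in 𝒟_[n+1,u] gives the recurrence
--   A^{(q)}_{[n+1,u]} = A^{(q)}_{[n,u-1]} + Σ_j A^{(q)}_{[n,u+j]} a^{(j)}_{q+u},
-- with A^{(q)}_{[0,u]} = δ_{u,0}; for q = u = 0 it is the first identity coefficientwise.
-- For the second, A_{[N+1,i+1+u]} and Σ_k A_{[k,i]} A^{(i+1)}_{[N-k,u]} satisfy the same
-- recurrence in (N, u) with the same initial values, so they agree by induction on N.

open import Defs
open import Level using (Level)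
open import Algebra.Bundles using (Semiring; CommutativeRing)
import Algebra.Properties.CommutativeSemigroup as CommutativeSemigroupProperties
open import Data.Bool using (Bool; true; false; _∧_; if_then_else_)
import Data.Bool.Properties as Bool
open import Data.Fin using (Fin; toℕ)
open import Data.Integer as ℤ using (ℤ; +_; -[1+_]; +≤+)
import Data.Integer.Properties as ℤ
open import Data.List using (List; []; _∷_; _++_; map; foldr; upTo; allFin; concatMap; filterᵇ)
import Data.List.Properties as List
open import Data.List.Membership.Propositional using (_∈_)
open import Data.List.Membership.Propositional.Properties using (∈-upTo⁻)
open import Data.List.Relation.Unary.Any using (here; there)
open import Data.Nat as ℕ using (ℕ; zero; suc; _∸_; _<_; _≤_; z≤n)
import Data.Nat.Properties as ℕ
open import Data.Product using (_×_; _,_)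
open import Function using (_∘_)
open import Relation.Binary.PropositionalEquality as ≡ using (_≡_)
open import Relation.Nullary using (yes; no; does)
open import Relation.Nullary.Decidable using (dec-true; dec-false)
import Relation.Binary.Reasoning.Setoid as SetoidReasoning

module ListSum {c ℓ : Level} (R : Semiring c ℓ) where
  open Semiring R
  open SetoidReasoning setoid
  open CommutativeSemigroupProperties +-commutativeSemigroup using (interchange)

  ∑ : {A : Set} → List A → (A → Carrier) → Carrier
  ∑ xs f = foldr _+_ 0# (map f xs)

  private variable A B : Set

  ∑-cong-∈ : ∀ (xs : List A) {f g} → (∀ {x} → x ∈ xs → f x ≈ g x) → ∑ xs f ≈ ∑ xs g
  ∑-cong-∈ []       _  = refl
  ∑-cong-∈ (x ∷ xs) eq = +-cong (eq (here ≡.refl)) (∑-cong-∈ xs (eq ∘ there))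

  ∑-cong : ∀ (xs : List A) {f g} → (∀ x → f x ≈ g x) → ∑ xs f ≈ ∑ xs g
  ∑-cong xs eq = ∑-cong-∈ xs (λ {x} _ → eq x)

  ∑-zero : ∀ (xs : List A) {f} → (∀ x → f x ≈ 0#) → ∑ xs f ≈ 0#
  ∑-zero []       _  = refl
  ∑-zero (x ∷ xs) eq = trans (+-cong (eq x) (∑-zero xs eq)) (+-identityʳ 0#)

  ∑-+ : ∀ (xs : List A) f g → ∑ xs (λ x → f x + g x) ≈ ∑ xs f + ∑ xs g
  ∑-+ []       f g = sym (+-identityʳ 0#)
  ∑-+ (x ∷ xs) f g = trans (+-congˡ (∑-+ xs f g)) (interchange _ _ _ _)

  ∑-*ˡ : ∀ (xs : List A) y f → ∑ xs (λ x → y * f x) ≈ y * ∑ xs f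
  ∑-*ˡ []       y f = sym (zeroʳ y)
  ∑-*ˡ (x ∷ xs) y f = trans (+-congˡ (∑-*ˡ xs y f)) (sym (distribˡ y _ _))

  ∑-*ʳ : ∀ (xs : List A) f y → ∑ xs (λ x → f x * y) ≈ ∑ xs f * y
  ∑-*ʳ []       f y = sym (zeroˡ y)
  ∑-*ʳ (x ∷ xs) f y = trans (+-congˡ (∑-*ʳ xs f y)) (sym (distribʳ y _ _))

  ∑-comm : ∀ (xs : List A) (ys : List B) (f : A → B → Carrier) →
           ∑ xs (λ x → ∑ ys (f x)) ≈ ∑ ys (λ y → ∑ xs (λ x → f x y))
  ∑-comm []       ys f = sym (∑-zero ys (λ _ → refl))
  ∑-comm (x ∷ xs) ys f = trans (+-congˡ (∑-comm xs ys f)) (sym (∑-+ ys (f x) _))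

  ∑-++ : ∀ (xs ys : List A) f → ∑ (xs ++ ys) f ≈ ∑ xs f + ∑ ys f
  ∑-++ []       ys f = sym (+-identityˡ _)
  ∑-++ (x ∷ xs) ys f = trans (+-congˡ (∑-++ xs ys f)) (sym (+-assoc _ _ _))

  ∑-map : ∀ (g : A → B) (xs : List A) f → ∑ (map g xs) f ≈ ∑ xs (f ∘ g)
  ∑-map g xs f = reflexive (≡.cong (foldr _+_ 0#) (≡.sym (List.map-∘ xs)))

  ∑-concatMap : ∀ (g : A → List B) (xs : List A) f →
                ∑ (concatMap g xs) f ≈ ∑ xs (λ x → ∑ (g x) f)
  ∑-concatMap g []       f = refl
  ∑-concatMap g (x ∷ xs) f = trans (∑-++ (g x) _ f) (+-congˡ (∑-concatMap g xs f))

  ∑-filterᵇ : ∀ (P : A → Bool) (xs : List A) f →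
              ∑ (filterᵇ P xs) f ≈ ∑ xs (λ x → if P x then f x else 0#)
  ∑-filterᵇ P []       f = refl
  ∑-filterᵇ P (x ∷ xs) f with P x
  ... | true  = +-congˡ (∑-filterᵇ P xs f)
  ... | false = trans (∑-filterᵇ P xs f) (sym (+-identityˡ _))

  ∑-upTo-sucʳ : ∀ n f → ∑ (upTo (suc n)) f ≈ ∑ (upTo n) f + f n
  ∑-upTo-sucʳ n f = begin
    ∑ (upTo (suc n)) f         ≡⟨ ≡.cong (λ ks → ∑ ks f) (≡.sym (List.upTo-∷ʳ n)) ⟩
    ∑ (upTo n ++ n ∷ []) f     ≈⟨ ∑-++ (upTo n) _ f ⟩
    ∑ (upTo n) f + (f n + 0#)  ≈⟨ +-congˡ (+-identityʳ _) ⟩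
    ∑ (upTo n) f + f n         ∎

  ∑-upTo-sucˡ : ∀ n f → ∑ (upTo (suc n)) f ≈ f 0 + ∑ (upTo n) (f ∘ suc)
  ∑-upTo-sucˡ n f = +-congˡ (reflexive (≡.cong (foldr _+_ 0#)
    (≡.trans (List.map-applyUpTo suc f n) (≡.sym (List.map-upTo (f ∘ suc) n)))))

  ∑-upTo-suc-∸ : ∀ n (f : ℕ → ℕ → Carrier) →
             ∑ (upTo (suc n)) (λ k → f k (suc n ∸ k)) ≈ ∑ (upTo (suc n)) (λ k → f k (suc (n ∸ k)))
  ∑-upTo-suc-∸ n f = ∑-cong-∈ (upTo (suc n))
    (λ k∈ → reflexive (≡.cong (f _) (ℕ.+-∸-assoc 1 (ℕ.≤-pred (∈-upTo⁻ k∈)))))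

module LastStepRecurrence {c ℓ : Level} (R : Semiring c ℓ) (p : ℕ) where
  open Semiring R hiding (zero)
  open ListSum R
  open SetoidReasoning setoid

  shift : (ℕ → Carrier) → ℕ → Carrier
  shift f zero    = 0#
  shift f (suc u) = f u

  -- W q n u stands for A^{(q)}_{[n,u]} and b j h for a^{(j)}_h.
  module _ (b : Fin (suc p) → ℕ → Carrier) (W : ℕ → ℕ → ℕ → Carrier)
           (W-0-0   : ∀ q → W q 0 0 ≈ 1#)
           (W-0-suc : ∀ q u → W q 0 (suc u) ≈ 0#)
           (W-suc   : ∀ q n u → W q (suc n) u ≈
                        shift (W q n) u + ∑ (allFin (suc p)) (λ j → W q n (u ℕ.+ toℕ j) * b j (q ℕ.+ u)))
           where

    W-0-+ : ∀ q q′ i u → W q 0 (i ℕ.+ u) ≈ W q 0 i * W q′ 0 u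
    W-0-+ q q′ zero    zero    = trans (W-0-0 q) (sym (trans (*-cong (W-0-0 q) (W-0-0 q′)) (*-identityʳ 1#)))
    W-0-+ q q′ zero    (suc u) = trans (W-0-suc q u) (sym (trans (*-congˡ (W-0-suc q′ u)) (zeroʳ _)))
    W-0-+ q q′ (suc i) u       = trans (W-0-suc q _) (sym (trans (*-congʳ (W-0-suc q i)) (zeroˡ _)))

    convolved : ℕ → ℕ → ℕ → ℕ → Carrier
    convolved q i N u = ∑ (upTo (suc N)) (λ k → W q k i * W (q ℕ.+ suc i) (N ∸ k) u)

    convolved-suc : ∀ q i N u → let q′ = q ℕ.+ suc i in
      convolved q i (suc N) u ≈
        (∑ (upTo (suc N)) (λ k → W q k i * shift (W q′ (N ∸ k)) u)
         + ∑ (allFin (suc p)) (λ j → convolved q i N (u ℕ.+ toℕ j) * b j (q′ ℕ.+ u)))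
        + W q (suc N) i * W q′ 0 u
    convolved-suc q i N u = begin
      ∑ (upTo (suc (suc N))) (λ k → W q k i * W q′ (suc N ∸ k) u)
        ≈⟨ ∑-upTo-sucʳ (suc N) _ ⟩
      ∑ (upTo (suc N)) (λ k → W q k i * W q′ (suc N ∸ k) u) + W q (suc N) i * W q′ (N ∸ N) u
        ≈⟨ +-cong (∑-upTo-suc-∸ N (λ k m → W q k i * W q′ m u))
                  (reflexive (≡.cong (λ m → W q (suc N) i * W q′ m u) (ℕ.n∸n≡0 N))) ⟩
      ∑ (upTo (suc N)) (λ k → W q k i * W q′ (suc (N ∸ k)) u) + last
        ≈⟨ +-congʳ (∑-cong (upTo (suc N)) (λ k → trans (*-congˡ (W-suc q′ (N ∸ k) u)) (distribˡ _ _ _))) ⟩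
      ∑ (upTo (suc N)) (λ k → W q k i * shift (W q′ (N ∸ k)) u + W q k i * ∑ F (term k)) + last
        ≈⟨ +-congʳ (∑-+ (upTo (suc N)) _ _) ⟩
      (∑ (upTo (suc N)) (λ k → W q k i * shift (W q′ (N ∸ k)) u) + ∑ (upTo (suc N)) (λ k → W q k i * ∑ F (term k))) + last
        ≈⟨ +-congʳ (+-congˡ downSteps) ⟩
      (∑ (upTo (suc N)) (λ k → W q k i * shift (W q′ (N ∸ k)) u)
       + ∑ F (λ j → convolved q i N (u ℕ.+ toℕ j) * b j (q′ ℕ.+ u)))
        + last ∎
      where
      q′ : ℕ
      q′ = q ℕ.+ suc i
      F : List (Fin (suc p))
      F = allFin (suc p)
      last : Carrier
      last = W q (suc N) i * W q′ 0 u
      term : ℕ → Fin (suc p) → Carrier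
      term k j = W q′ (N ∸ k) (u ℕ.+ toℕ j) * b j (q′ ℕ.+ u)
      downSteps : ∑ (upTo (suc N)) (λ k → W q k i * ∑ F (term k))
                ≈ ∑ F (λ j → convolved q i N (u ℕ.+ toℕ j) * b j (q′ ℕ.+ u))
      downSteps = begin
        ∑ (upTo (suc N)) (λ k → W q k i * ∑ F (term k))
          ≈⟨ ∑-cong (upTo (suc N)) (λ k → trans (sym (∑-*ˡ F _ (term k))) (∑-cong F (λ _ → sym (*-assoc _ _ _)))) ⟩
        ∑ (upTo (suc N)) (λ k → ∑ F (λ j → (W q k i * W q′ (N ∸ k) (u ℕ.+ toℕ j)) * b j (q′ ℕ.+ u)))
          ≈⟨ ∑-comm (upTo (suc N)) F _ ⟩
        ∑ F (λ j → ∑ (upTo (suc N)) (λ k → (W q k i * W q′ (N ∸ k) (u ℕ.+ toℕ j)) * b j (q′ ℕ.+ u)))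
          ≈⟨ ∑-cong F (λ j → ∑-*ʳ (upTo (suc N)) _ _) ⟩
        ∑ F (λ j → convolved q i N (u ℕ.+ toℕ j) * b j (q′ ℕ.+ u)) ∎

    convolution : ∀ q i N u → W q (suc N) (suc i ℕ.+ u) ≈ convolved q i N u
    convolution q i zero    u = trans (W-suc q 0 (suc i ℕ.+ u))
      (+-cong (W-0-+ q (q ℕ.+ suc i) i u)
              (∑-zero (allFin (suc p)) (λ j → trans (*-congʳ (W-0-suc q _)) (zeroˡ _))))
    convolution q i (suc N) u = begin
      W q (suc (suc N)) (suc i ℕ.+ u)
        ≈⟨ W-suc q (suc N) (suc i ℕ.+ u) ⟩
      W q (suc N) (i ℕ.+ u) + ∑ F (λ j → W q (suc N) (suc i ℕ.+ u ℕ.+ toℕ j) * b j (q ℕ.+ (suc i ℕ.+ u)))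
        ≈⟨ +-congˡ (∑-cong F (λ j → *-cong (trans (reflexive (≡.cong (W q (suc N)) (ℕ.+-assoc (suc i) u (toℕ j))))
                                                   (convolution q i N (u ℕ.+ toℕ j)))
                                            (reflexive (≡.cong (b j) (≡.sym (ℕ.+-assoc q (suc i) u)))))) ⟩
      W q (suc N) (i ℕ.+ u) + X u
        ≈⟨ upSteps u ⟩
      (∑ (upTo (suc N)) (λ k → W q k i * shift (W q′ (N ∸ k)) u) + X u) + W q (suc N) i * W q′ 0 u
        ≈⟨ convolved-suc q i N u ⟨
      convolved q i (suc N) u ∎
      where
      q′ : ℕ
      q′ = q ℕ.+ suc i
      F : List (Fin (suc p))
      F = allFin (suc p)
      X : ℕ → Carrier
      X u = ∑ F (λ j → convolved q i N (u ℕ.+ toℕ j) * b j (q′ ℕ.+ u))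
      upSteps : ∀ u → W q (suc N) (i ℕ.+ u) + X u ≈
                 (∑ (upTo (suc N)) (λ k → W q k i * shift (W q′ (N ∸ k)) u) + X u) + W q (suc N) i * W q′ 0 u
      upSteps zero = begin
        W q (suc N) (i ℕ.+ 0) + X 0
          ≈⟨ +-congʳ (reflexive (≡.cong (W q (suc N)) (ℕ.+-identityʳ i))) ⟩
        W q (suc N) i + X 0
          ≈⟨ +-comm _ _ ⟩
        X 0 + W q (suc N) i
          ≈⟨ +-cong (sym (trans (+-congʳ (∑-zero (upTo (suc N)) (λ _ → zeroʳ _))) (+-identityˡ _)))
                    (sym (trans (*-congˡ (W-0-0 q′)) (*-identityʳ _))) ⟩
        (∑ (upTo (suc N)) (λ k → W q k i * 0#) + X 0) + W q (suc N) i * W q′ 0 0 ∎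
      upSteps (suc u) = begin
        W q (suc N) (i ℕ.+ suc u) + X (suc u)
          ≈⟨ +-congʳ (reflexive (≡.cong (W q (suc N)) (ℕ.+-suc i u))) ⟩
        W q (suc N) (suc i ℕ.+ u) + X (suc u)
          ≈⟨ +-congʳ (convolution q i N u) ⟩
        convolved q i N u + X (suc u)
          ≈⟨ +-identityʳ _ ⟨
        (convolved q i N u + X (suc u)) + 0#
          ≈⟨ +-congˡ (trans (*-congˡ (W-0-suc q′ u)) (zeroʳ _)) ⟨
        (convolved q i N u + X (suc u)) + W q (suc N) i * W q′ 0 (suc u) ∎

module PathSums {c ℓ : Level} (R : Semiring c ℓ) (p : ℕ) where
  open Semiring R hiding (zero)
  open ListSum R

  ∑-allPaths-suc : ∀ n f →
    ∑ (allPaths p (suc n)) f ≈ ∑ (allSteps p) (λ s → ∑ (allPaths p n) (λ α → f (s ∷ α)))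
  ∑-allPaths-suc n f = trans (∑-concatMap (λ s → map (s ∷_) (allPaths p n)) (allSteps p) f)
    (∑-cong (allSteps p) (λ s → ∑-map (s ∷_) (allPaths p n) f))

  ∑-allPaths-snoc : ∀ n f →
    ∑ (allPaths p (suc n)) f ≈ ∑ (allPaths p n) (λ α → ∑ (allSteps p) (λ s → f (α ++ s ∷ [])))
  ∑-allPaths-snoc zero    f = trans (∑-allPaths-suc zero f)
    (trans (∑-cong (allSteps p) (λ _ → +-identityʳ _)) (sym (+-identityʳ _)))
  ∑-allPaths-snoc (suc n) f = begin
    ∑ (allPaths p (suc (suc n))) f
      ≈⟨ ∑-allPaths-suc (suc n) f ⟩
    ∑ (allSteps p) (λ s → ∑ (allPaths p (suc n)) (λ α → f (s ∷ α)))
      ≈⟨ ∑-cong (allSteps p) (λ s → ∑-allPaths-snoc n (λ α → f (s ∷ α))) ⟩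
    ∑ (allSteps p) (λ s → ∑ (allPaths p n) (λ α → ∑ (allSteps p) (λ t → f (s ∷ α ++ t ∷ []))))
      ≈⟨ ∑-allPaths-suc n _ ⟨
    ∑ (allPaths p (suc n)) (λ α → ∑ (allSteps p) (λ t → f (α ++ t ∷ [])))
      ∎
    where open SetoidReasoning setoid

i+k-k≡i : ∀ i k → (i ℤ.+ k) ℤ.- k ≡ i
i+k-k≡i i k = ≡.trans (ℤ.+-assoc i k (ℤ.- k))
  (≡.trans (≡.cong (λ z → i ℤ.+ z) (ℤ.+-inverseʳ k)) (ℤ.+-identityʳ i))

i-k+k≡i : ∀ i k → (i ℤ.- k) ℤ.+ k ≡ i
i-k+k≡i i k = ≡.trans (ℤ.+-assoc i (ℤ.- k) k)
  (≡.trans (≡.cong (λ z → i ℤ.+ z) (ℤ.+-inverseˡ k)) (ℤ.+-identityʳ i))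

module _ {p : ℕ} where

  endHeight-++ : ∀ h (α β : List (Step p)) → endHeight h (α ++ β) ≡ endHeight (endHeight h α) β
  endHeight-++ h []      β = ≡.refl
  endHeight-++ h (s ∷ α) β = endHeight-++ (next h s) α β

  nonneg-++ : ∀ h (α β : List (Step p)) → nonneg h (α ++ β) ≡ nonneg h α ∧ nonneg (endHeight h α) β
  nonneg-++ h []      β = ≡.refl
  nonneg-++ h (s ∷ α) β = ≡.trans (≡.cong (does (+ 0 ℤ.≤? next h s) ∧_) (nonneg-++ (next h s) α β))
    (≡.sym (Bool.∧-assoc (does (+ 0 ℤ.≤? next h s)) _ _))

  endHeight-+ : ∀ k h (α : List (Step p)) → endHeight (k ℤ.+ h) α ≡ k ℤ.+ endHeight h α
  endHeight-+ k h []           = ≡.refl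
  endHeight-+ k h (up ∷ α)     = ≡.trans (≡.cong (λ h′ → endHeight h′ α) (ℤ.+-assoc k h _)) (endHeight-+ k _ α)
  endHeight-+ k h (down j ∷ α) = ≡.trans (≡.cong (λ h′ → endHeight h′ α) (ℤ.+-assoc k h _)) (endHeight-+ k _ α)

  endHeight-from : ∀ q (α : List (Step p)) → endHeight (+ q) α ≡ + q ℤ.+ endHeight (+ 0) α
  endHeight-from q α = ≡.trans (≡.cong (λ h → endHeight h α) (≡.cong +_ (≡.sym (ℕ.+-identityʳ q))))
    (endHeight-+ (+ q) (+ 0) α)

  nonneg⇒endHeight≥0 : ∀ h (α : List (Step p)) → + 0 ℤ.≤ h → nonneg h α ≡ true → + 0 ℤ.≤ endHeight h α
  nonneg⇒endHeight≥0 h []      h≥0 _ = h≥0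
  nonneg⇒endHeight≥0 h (s ∷ α) _   eq with + 0 ℤ.≤? next h s
  ... | yes h′≥0 = nonneg⇒endHeight≥0 (next h s) α h′≥0 eq
  ... | no _ with () ← eq

  inD⇒endHeight : ∀ u (α : List (Step p)) → inD u α ≡ true → endHeight (+ 0) α ≡ + u
  inD⇒endHeight u α eq with endHeight (+ 0) α ℤ.≟ + u
  ... | yes e≡u = e≡u
  ... | no _ with () ← eq

  inD-snoc-up-0 : ∀ (α : List (Step p)) → inD 0 (α ++ up ∷ []) ≡ false
  inD-snoc-up-0 α rewrite endHeight-++ (+ 0) α (up ∷ []) | nonneg-++ (+ 0) α (up ∷ []) =
    lastStep (endHeight (+ 0) α) (nonneg (+ 0) α) (nonneg⇒endHeight≥0 (+ 0) α (+≤+ z≤n))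
    where
    lastStep : ∀ e b → (b ≡ true → + 0 ℤ.≤ e) →
               does (e ℤ.+ + 1 ℤ.≟ + 0) ∧ (b ∧ (does (+ 0 ℤ.≤? e ℤ.+ + 1) ∧ true)) ≡ false
    lastStep e false _ = Bool.∧-zeroʳ _
    lastStep e true e≥0 with e ℤ.+ + 1 ℤ.≟ + 0
    ... | no _   = ≡.refl
    ... | yes eq with () ← ≡.subst (+ 0 ℤ.≤_) (≡.trans (≡.sym (i+k-k≡i e (+ 1))) (≡.cong (ℤ._- + 1) eq))
                                   (e≥0 ≡.refl)

  inD-snoc-up : ∀ u (α : List (Step p)) → inD (suc u) (α ++ up ∷ []) ≡ inD u α
  inD-snoc-up u α rewrite endHeight-++ (+ 0) α (up ∷ []) | nonneg-++ (+ 0) α (up ∷ []) =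
    lastStep (endHeight (+ 0) α) (nonneg (+ 0) α)
    where
    lastStep : ∀ e b → does (e ℤ.+ + 1 ℤ.≟ + suc u) ∧ (b ∧ (does (+ 0 ℤ.≤? e ℤ.+ + 1) ∧ true))
                       ≡ does (e ℤ.≟ + u) ∧ b
    lastStep e b with e ℤ.≟ + u
    ... | yes ≡.refl
      rewrite dec-true (+ u ℤ.+ + 1 ℤ.≟ + suc u) (≡.cong +_ (ℕ.+-comm u 1))
            | dec-true (+ 0 ℤ.≤? + u ℤ.+ + 1) (+≤+ z≤n) = Bool.∧-identityʳ b
    ... | no e≢u = ≡.cong (_∧ _) (dec-false (e ℤ.+ + 1 ℤ.≟ + suc u)
            (λ eq → e≢u (≡.trans (≡.sym (i+k-k≡i e (+ 1))) (≡.cong (ℤ._- + 1) eq))))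

  inD-snoc-down : ∀ u j (α : List (Step p)) → inD u (α ++ down j ∷ []) ≡ inD (u ℕ.+ toℕ j) α
  inD-snoc-down u j α rewrite endHeight-++ (+ 0) α (down j ∷ []) | nonneg-++ (+ 0) α (down j ∷ []) =
    lastStep (endHeight (+ 0) α) (nonneg (+ 0) α)
    where
    k : ℤ
    k = + toℕ j
    lastStep : ∀ e b → does (e ℤ.- k ℤ.≟ + u) ∧ (b ∧ (does (+ 0 ℤ.≤? e ℤ.- k) ∧ true))
                       ≡ does (e ℤ.≟ + (u ℕ.+ toℕ j)) ∧ b
    lastStep e b with e ℤ.≟ + (u ℕ.+ toℕ j)
    ... | yes ≡.refl
      rewrite i+k-k≡i (+ u) k
            | dec-true (+ u ℤ.≟ + u) ≡.refl
            | dec-true (+ 0 ℤ.≤? + u) (+≤+ z≤n) = Bool.∧-identityʳ b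
    ... | no e≢u+j = ≡.cong (_∧ _) (dec-false (e ℤ.- k ℤ.≟ + u)
            (λ eq → e≢u+j (≡.trans (≡.sym (i-k+k≡i e k)) (≡.cong (ℤ._+ k) eq))))

module PathWeights {c ℓ : Level} (R : CommutativeRing c ℓ) (p : ℕ)
                   (a : Fin (suc p) → ℤ → CommutativeRing.Carrier R) where
  open CommutativeRing R hiding (zero)
  open Paths R p a
  open ListSum semiring
  open PathSums semiring p

  arrivalWeight : ℤ → Step p → Carrier
  arrivalWeight h up       = 1#
  arrivalWeight h (down j) = a j h

  weight-++ : ∀ h (α β : List (Step p)) → weight h (α ++ β) ≈ weight h α * weight (endHeight h α) β
  weight-++ h []           β = sym (*-identityˡ _)
  weight-++ h (up ∷ α)     β = trans (*-congˡ (weight-++ _ α β)) (sym (*-assoc _ _ _))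
  weight-++ h (down j ∷ α) β = trans (*-congˡ (weight-++ _ α β)) (sym (*-assoc _ _ _))

  weight-step : ∀ h s → weight h (s ∷ []) ≈ arrivalWeight (next h s) s
  weight-step h up       = *-identityʳ 1#
  weight-step h (down j) = *-identityʳ _

  weight-snoc-inD : ∀ q u α s → inD u (α ++ s ∷ []) ≡ true →
                    weight (+ q) (α ++ s ∷ []) ≈ weight (+ q) α * arrivalWeight (+ (q ℕ.+ u)) s
  weight-snoc-inD q u α s γ∈𝒟 = trans (weight-++ (+ q) α (s ∷ []))
    (*-congˡ (trans (weight-step _ s) (reflexive (≡.cong (λ h → arrivalWeight h s) arrival))))
    where
    arrival : next (endHeight (+ q) α) s ≡ + (q ℕ.+ u)
    arrival = begin
      next (endHeight (+ q) α) s                ≡⟨ endHeight-++ (+ q) α (s ∷ []) ⟨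
      endHeight (+ q) (α ++ s ∷ [])             ≡⟨ endHeight-from q (α ++ s ∷ []) ⟩
      + q ℤ.+ endHeight (+ 0) (α ++ s ∷ [])     ≡⟨ ≡.cong (λ e → + q ℤ.+ e) (inD⇒endHeight u (α ++ s ∷ []) γ∈𝒟) ⟩
      + (q ℕ.+ u)                                ∎
      where open ≡.≡-Reasoning

  open LastStepRecurrence semiring p using (shift)
  open SetoidReasoning setoid

  weightIn𝒟 : ℕ → ℕ → List (Step p) → Carrier
  weightIn𝒟 q u γ = if inD u γ then weight (+ q) γ else 0#

  Acoef-∑ : ∀ q n u → Acoef q n u ≈ ∑ (allPaths p n) (weightIn𝒟 q u)
  Acoef-∑ q n u = ∑-filterᵇ (inD u) (allPaths p n) (weight (+ q))

  weightIn𝒟-snoc : ∀ q u α s → weightIn𝒟 q u (α ++ s ∷ []) ≈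
    (if inD u (α ++ s ∷ []) then weight (+ q) α * arrivalWeight (+ (q ℕ.+ u)) s else 0#)
  weightIn𝒟-snoc q u α s with inD u (α ++ s ∷ []) in γ∈𝒟
  ... | true  = weight-snoc-inD q u α s γ∈𝒟
  ... | false = refl

  weightIn𝒟-snoc-up : ∀ q u α → weightIn𝒟 q u (α ++ up ∷ []) ≈ shift (λ u′ → weightIn𝒟 q u′ α) u
  weightIn𝒟-snoc-up q zero α =
    reflexive (≡.cong (λ b → if b then weight (+ q) (α ++ up ∷ []) else 0#) (inD-snoc-up-0 α))
  weightIn𝒟-snoc-up q (suc u) α = begin
    weightIn𝒟 q (suc u) (α ++ up ∷ [])
      ≈⟨ weightIn𝒟-snoc q (suc u) α up ⟩
    (if inD (suc u) (α ++ up ∷ []) then weight (+ q) α * 1# else 0#)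
      ≡⟨ ≡.cong (λ b → if b then weight (+ q) α * 1# else 0#) (inD-snoc-up u α) ⟩
    (if inD u α then weight (+ q) α * 1# else 0#)
      ≈⟨ dropUp (inD u α) ⟩
    weightIn𝒟 q u α ∎
    where
    dropUp : ∀ b → (if b then weight (+ q) α * 1# else 0#) ≈ (if b then weight (+ q) α else 0#)
    dropUp true  = *-identityʳ _
    dropUp false = refl

  weightIn𝒟-snoc-down : ∀ q u j α → weightIn𝒟 q u (α ++ down j ∷ []) ≈
                        weightIn𝒟 q (u ℕ.+ toℕ j) α * a j (+ (q ℕ.+ u))
  weightIn𝒟-snoc-down q u j α = begin
    weightIn𝒟 q u (α ++ down j ∷ [])
      ≈⟨ weightIn𝒟-snoc q u α (down j) ⟩
    (if inD u (α ++ down j ∷ []) then weight (+ q) α * h else 0#)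
      ≡⟨ ≡.cong (λ b → if b then weight (+ q) α * h else 0#) (inD-snoc-down u j α) ⟩
    (if inD (u ℕ.+ toℕ j) α then weight (+ q) α * h else 0#)
      ≈⟨ factorOut (inD (u ℕ.+ toℕ j) α) ⟩
    weightIn𝒟 q (u ℕ.+ toℕ j) α * h ∎
    where
    h : Carrier
    h = a j (+ (q ℕ.+ u))
    factorOut : ∀ b → (if b then weight (+ q) α * h else 0#) ≈ (if b then weight (+ q) α else 0#) * h
    factorOut true  = refl
    factorOut false = sym (zeroˡ h)

  Acoef-0-0 : ∀ q → Acoef q 0 0 ≈ 1#
  Acoef-0-0 q = +-identityʳ 1#

  Acoef-0-suc : ∀ q u → Acoef q 0 (suc u) ≈ 0#
  Acoef-0-suc q u = refl

  Acoef-suc : ∀ q n u → Acoef q (suc n) u ≈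
    shift (Acoef q n) u + ∑ (allFin (suc p)) (λ j → Acoef q n (u ℕ.+ toℕ j) * a j (+ (q ℕ.+ u)))
  Acoef-suc q n u = begin
    Acoef q (suc n) u
      ≈⟨ Acoef-∑ q (suc n) u ⟩
    ∑ (allPaths p (suc n)) (weightIn𝒟 q u)
      ≈⟨ ∑-allPaths-snoc n (weightIn𝒟 q u) ⟩
    ∑ (allPaths p n) (λ α → ∑ (allSteps p) (λ s → weightIn𝒟 q u (α ++ s ∷ [])))
      ≈⟨ ∑-cong (allPaths p n) (λ α → +-cong (weightIn𝒟-snoc-up q u α)
           (trans (∑-map down F _) (∑-cong F (λ j → weightIn𝒟-snoc-down q u j α)))) ⟩
    ∑ (allPaths p n) (λ α → shift (λ u′ → weightIn𝒟 q u′ α) u + ∑ F (λ j → weightIn𝒟 q (u ℕ.+ toℕ j) α * h j))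
      ≈⟨ ∑-+ (allPaths p n) _ _ ⟩
    ∑ (allPaths p n) (λ α → shift (λ u′ → weightIn𝒟 q u′ α) u)
      + ∑ (allPaths p n) (λ α → ∑ F (λ j → weightIn𝒟 q (u ℕ.+ toℕ j) α * h j))
      ≈⟨ +-cong (upStep u) (∑-comm (allPaths p n) F _) ⟩
    shift (Acoef q n) u + ∑ F (λ j → ∑ (allPaths p n) (λ α → weightIn𝒟 q (u ℕ.+ toℕ j) α * h j))
      ≈⟨ +-congˡ (∑-cong F (λ j → trans (∑-*ʳ (allPaths p n) _ (h j)) (*-congʳ (sym (Acoef-∑ q n _))))) ⟩
    shift (Acoef q n) u + ∑ F (λ j → Acoef q n (u ℕ.+ toℕ j) * h j) ∎
    where
    F : List (Fin (suc p))
    F = allFin (suc p)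
    h : Fin (suc p) → Carrier
    h j = a j (+ (q ℕ.+ u))
    upStep : ∀ u → ∑ (allPaths p n) (λ α → shift (λ u′ → weightIn𝒟 q u′ α) u) ≈ shift (Acoef q n) u
    upStep zero    = ∑-zero (allPaths p n) (λ _ → refl)
    upStep (suc u) = sym (Acoef-∑ q n u)

module LaurentSeries {c ℓ : Level} (R : CommutativeRing c ℓ) where
  open CommutativeRing R hiding (zero)
  open Laurent R
  open ListSum semiring

  coeff⇒≈L : ∀ {m cf cg} → (∀ n → cf n ≈ cg n) → mkLS m cf ≈L mkLS m cg
  coeff⇒≈L {m} eq e with + m ℤ.- e
  ... | + k      = eq k
  ... | -[1+ _ ] = refl

  ΣL-series : ∀ n (cf : Fin n → ℕ → Carrier) →
              ΣL n (λ j → mkLS 0 (cf j)) ≈L mkLS 0 (λ k → ∑ (allFin n) (λ j → cf j k))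
  ΣL-series n cf e = trans (reflexive (coef-ord (ord-Σ (allFin n)))) (coeff⇒≈L (coeff-Σ (allFin n)) e)
    where
    Σ : List (Fin n) → LS
    Σ xs = foldr _+L_ zeroL (map (λ j → mkLS 0 (cf j)) xs)

    ord-Σ : ∀ xs → ord (Σ xs) ≡ 0
    ord-Σ []       = ≡.refl
    ord-Σ (_ ∷ xs) = ord-Σ xs

    coef-ord : ∀ {f} → ord f ≡ 0 → coef f e ≡ coef (mkLS 0 (coeff f)) e
    coef-ord {mkLS _ _} ≡.refl = ≡.refl

    +L-coeff : ∀ c₀ g → ord g ≡ 0 → ∀ k → coeff (mkLS 0 c₀ +L g) k ≈ c₀ k + coeff g k
    +L-coeff c₀ (mkLS _ _) ≡.refl zero    = refl
    +L-coeff c₀ (mkLS _ _) ≡.refl (suc k) = refl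

    coeff-Σ : ∀ xs k → coeff (Σ xs) k ≈ ∑ xs (λ j → cf j k)
    coeff-Σ []       k = refl
    coeff-Σ (x ∷ xs) k = trans (+L-coeff (cf x) (Σ xs) (ord-Σ xs) k) (+-congˡ (coeff-Σ xs k))

  *L-coeff-suc : ∀ f g → coeff f 0 ≈ 0# → coeff g 0 ≈ 0# → ∀ n →
                 coeff (f *L g) (suc n) ≈ ∑ (upTo n) (λ k → coeff f (suc k) * coeff g (n ∸ k))
  *L-coeff-suc f g f₀≈0 g₀≈0 n = begin
    ∑ (upTo (suc (suc n))) (λ k → coeff f k * coeff g (suc n ∸ k))
      ≈⟨ ∑-upTo-sucˡ (suc n) _ ⟩
    coeff f 0 * coeff g (suc n) + ∑ (upTo (suc n)) (λ k → coeff f (suc k) * coeff g (n ∸ k))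
      ≈⟨ +-cong (trans (*-congʳ f₀≈0) (zeroˡ _)) (∑-upTo-sucʳ n _) ⟩
    0# + (∑ (upTo n) (λ k → coeff f (suc k) * coeff g (n ∸ k)) + coeff f (suc n) * coeff g (n ∸ n))
      ≈⟨ +-identityˡ _ ⟩
    ∑ (upTo n) (λ k → coeff f (suc k) * coeff g (n ∸ k)) + coeff f (suc n) * coeff g (n ∸ n)
      ≈⟨ +-congˡ (trans (*-congˡ (trans (reflexive (≡.cong (coeff g) (ℕ.n∸n≡0 n))) g₀≈0)) (zeroʳ _)) ⟩
    ∑ (upTo n) (λ k → coeff f (suc k) * coeff g (n ∸ k)) + 0#
      ≈⟨ +-identityʳ _ ⟩
    ∑ (upTo n) (λ k → coeff f (suc k) * coeff g (n ∸ k)) ∎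
    where open SetoidReasoning setoid

module Identities {c ℓ : Level} (R : CommutativeRing c ℓ) (p : ℕ)
                  (a : Fin (suc p) → ℤ → CommutativeRing.Carrier R) where
  open CommutativeRing R hiding (zero)
  open Laurent R
  open Paths R p a
  open ListSum semiring
  open PathWeights R p a
  open LastStepRecurrence semiring p using (convolution)
  open LaurentSeries R
  open SetoidReasoning setoid

  A-last-step : zL (A 0 0) -L oneL ≈L ΣL (suc p) (λ j → a j (+ 0) •L A 0 (toℕ j))
  A-last-step e = trans (coefficients e) (sym (ΣL-series (suc p) (λ j n → a j (+ 0) * coeff (A 0 (toℕ j)) n) e))
    where
    F : List (Fin (suc p))
    F = allFin (suc p)
    coefficients : zL (A 0 0) -L oneL ≈L mkLS 0 (λ n → ∑ F (λ j → a j (+ 0) * coeff (A 0 (toℕ j)) n))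
    coefficients (+ zero) = begin
      Acoef 0 0 0 + - 1# * 1#  ≈⟨ +-cong (Acoef-0-0 0) (*-identityʳ _) ⟩
      1# + - 1#                ≈⟨ -‿inverseʳ 1# ⟩
      0#                       ≈⟨ ∑-zero F (λ _ → zeroʳ _) ⟨
      ∑ F (λ j → a j (+ 0) * 0#) ∎
    coefficients (+ suc zero)    = +-identityʳ 0#
    coefficients (+ suc (suc _)) = refl
    coefficients -[1+ m ] = begin
      Acoef 0 (suc m) 0 + - 1# * 0#
        ≈⟨ +-cong (Acoef-suc 0 m 0) (zeroʳ _) ⟩
      (0# + ∑ F (λ j → Acoef 0 m (toℕ j) * a j (+ 0))) + 0#
        ≈⟨ trans (+-identityʳ _) (+-identityˡ _) ⟩
      ∑ F (λ j → Acoef 0 m (toℕ j) * a j (+ 0))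
        ≈⟨ ∑-cong F (λ _ → *-comm _ _) ⟩
      ∑ F (λ j → a j (+ 0) * Acoef 0 m (toℕ j)) ∎

  A-factorization : ∀ i u → A 0 (suc i ℕ.+ u) ≈L A 0 i *L A (suc i) u
  A-factorization i u = coeff⇒≈L λ where
      zero    → sym (trans (+-identityʳ _) (zeroˡ _))
      (suc n) → trans (coefficients n) (sym (*L-coeff-suc (A 0 i) (A (suc i) u) refl refl n))
    where
    coefficients : ∀ n → Acoef 0 n (suc i ℕ.+ u) ≈ ∑ (upTo n) (λ k → Acoef 0 k i * coeff (A (suc i) u) (n ∸ k))
    coefficients zero    = Acoef-0-suc 0 (i ℕ.+ u)
    coefficients (suc N) = trans
      (convolution (λ j h → a j (+ h)) Acoef Acoef-0-0 Acoef-0-suc Acoef-suc 0 i N u)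
      (sym (∑-upTo-suc-∸ N (λ k m → Acoef 0 k i * coeff (A (suc i) u) m)))

suc-+-∸-∸ : ∀ {i j} → i < j → suc i ℕ.+ (j ∸ i ∸ 1) ≡ j
suc-+-∸-∸ {i} {j} i<j = ≡.trans
  (≡.cong (suc i ℕ.+_) (≡.trans (ℕ.∸-+-assoc j i 1) (≡.cong (j ∸_) (ℕ.+-comm i 1))))
  (ℕ.m+[n∸m]≡n i<j)

mainTheorem2 : {c ℓ : Level} (R : CommutativeRing c ℓ) (p : ℕ) → 1 ≤ p →
    (a : Fin (suc p) → ℤ → CommutativeRing.Carrier R) →
    let open Laurent R
        open Paths R p a
    in (zL (A 0 0) -L oneL ≈L ΣL (suc p) (λ j → a j (+ 0) •L A 0 (toℕ j)))
       × ((i j : ℕ) → i < j → j ≤ p →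
          A 0 j ≈L A 0 i *L A (suc i) (j ∸ i ∸ 1))
mainTheorem2 R p _ a = A-last-step , λ i j i<j _ →
  ≡.subst (λ m → A 0 m ≈L A 0 i *L A (suc i) (j ∸ i ∸ 1)) (suc-+-∸-∸ i<j) (A-factorization i (j ∸ i ∸ 1))
  where
  open Laurent R
  open Paths R p a
  open Identities R p a
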